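{- Let $S\subseteq\mathbb{Z}$ be a set of integers and, for $n>0$, let $\mathcal{A}_S^n=\{\{x_i-x_j=s\}: 1\le i<j\le n,\ s\in S\}$. The following are equivalent: (i) $\mathcal{A}_S^n$ is strongly transitive for every integer $n>0$; (ii) $\mathcal{A}_S^n$ is strongly transitive for at least one integer $n\ge 3$; (iii) for all integers $s,t\notin S$: if $st\ge 0$ then $s+t\notin S$, and if $st\le 0$ then $s-t\notin S$ and $t-s\notin S$.
   Context: For distinct $i,j\in[n]$ and $s\in\mathbb{Z}$, $\{x_i-x_j=s\}$ denotes the hyperplane $\{(x_1,\dots,x_n)\in\mathbb{R}^n: x_i-x_j=s\}$ (so $\{x_i-x_j=s\}=\{x_j-x_i=-s\}$). A set $\mathcal{A}$ of such hyperplanes in $\mathbb{R}^n$ is strongly transitive if for all distinct $i,j,k\in[n]$ and all integers $s,t\ge0$: if $\{x_i-x_j=s\}\notin\mathcal{A}$ and $\{x_j-x_k=t\}\notin\mathcal{A}$, then $\{x_i-x_k=s+t\}\notin\mathcal{A}$. -}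

module Defs where

open import Data.Nat using (ℕ)
open import Data.Fin using (Fin) renaming (_<_ to _<ᶠ_)
open import Data.Integer using (ℤ; _+_; _-_; _*_; -_; _≤_; 0ℤ)
open import Data.Product using (_×_)
open import Data.Sum using (_⊎_)
open import Relation.Nullary using (¬_)
open import Relation.Binary.PropositionalEquality using (_≢_)

-- A set of hyperplanes of the form {x_i - x_j = s} in ℝ^n is represented by its
-- membership predicate  A i j s  meaning "{x_i - x_j = s} ∈ A".
-- Since {x_i - x_j = s} = {x_j - x_i = -s} as sets, such a predicate must be
-- invariant under (i , j , s) ↦ (j , i , - s); the only arrangements used below
-- (the 𝒜 S n) are defined so that this holds by construction.
Arrangement : ℕ → Set₁
Arrangement n = Fin n → Fin n → ℤ → Set

-- 𝒜_S^n = { {x_i - x_j = s} : i < j , s ∈ S }.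
-- The hyperplane {x_a - x_b = s} (a ≢ b) belongs to it iff
-- either a < b and s ∈ S, or b < a and -s ∈ S (writing it as {x_b - x_a = -s}).
𝒜 : (ℤ → Set) → (n : ℕ) → Arrangement n
𝒜 S n a b s = (a <ᶠ b × S s) ⊎ (b <ᶠ a × S (- s))

StronglyTransitive : {n : ℕ} → Arrangement n → Set
StronglyTransitive {n} A =
  (i j k : Fin n) → i ≢ j → j ≢ k → i ≢ k →
  (s t : ℤ) → 0ℤ ≤ s → 0ℤ ≤ t →
  ¬ A i j s → ¬ A j k t → ¬ A i k (s + t)

Cond3 : (ℤ → Set) → Set
Cond3 S =
  (s t : ℤ) → ¬ S s → ¬ S t →
  (0ℤ ≤ s * t → ¬ S (s + t)) ×
  (s * t ≤ 0ℤ → ¬ S (s - t) × ¬ S (t - s))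

{-# OPTIONS --safe #-}
-- Give the pair (i, j) the orientation + if i < j and - if j < i.  Then
-- {x_i - x_j = s} ∉ 𝒜_S^n exactly when ε s ∉ S, ε the orientation of (i, j), so strong
-- transitivity says: for s, t ≥ 0, if ε s ∉ S and δ t ∉ S then γ (s + t) ∉ S, for every
-- pattern (ε, δ, γ) of orientations of (i, j), (j, k), (i, k).  These patterns are
-- (ε, ε, ε) and (ε, -ε, γ) with γ arbitrary, and all of them already occur among three
-- indices, which makes the condition independent of n ≥ 3.  Unfolding the patterns by the
-- signs of s and t gives condition (iii).
module Submission where

open import Defs
open import Data.Nat as ℕ using (ℕ; _<_; _≤_; z≤n; s≤s)
open import Data.Integer
  using (ℤ; 0ℤ; +_; +0; +[1+_]; -[1+_]; -_; _+_; _-_; _*_; +≤+; -≤+)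
  renaming (_≤_ to _≤ℤ_)
open import Data.Integer.Properties
  using (neg-involutive; neg-distrib-+; neg-distribˡ-*; neg-distribʳ-*; neg-mono-≤; pos-*; +-comm)
open import Data.Sign as Sign using (Sign; opposite)
open import Data.Fin using (Fin; zero; suc) renaming (_<_ to _<ᶠ_)
open import Data.Fin.Properties using (<-cmp; <-asym; <-trans; <-irrefl)
open import Data.Product using (_×_; _,_; proj₁; proj₂; ∃-syntax; map; swap)
open import Data.Sum using (_⊎_; inj₁; inj₂)
open import Data.Empty using (⊥-elim)
open import Relation.Nullary using (¬_)
open import Relation.Binary.Definitions using (tri<; tri≈; tri>)
open import Relation.Binary.PropositionalEquality using (_≡_; _≢_; refl; sym; trans; cong; cong₂; subst; module ≡-Reasoning)
open import Function.Bundles using (_⇔_; mk⇔)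

private
  variable
    n : ℕ
    a b : Fin n
    s t : ℤ
    ε δ γ : Sign

neg-*-neg : ∀ s t → - s * - t ≡ s * t
neg-*-neg s t = begin
  - s * - t     ≡⟨ neg-distribˡ-* s (- t) ⟨
  - (s * - t)   ≡⟨ cong -_ (neg-distribʳ-* s t) ⟨
  - - (s * t)   ≡⟨ neg-involutive (s * t) ⟩
  s * t         ∎
  where open ≡-Reasoning

neg-minus : ∀ s t → - (s - t) ≡ t - s
neg-minus s t = begin
  - (s + - t)   ≡⟨ neg-distrib-+ s (- t) ⟩
  - s + - - t   ≡⟨ cong (_+_ (- s)) (neg-involutive t) ⟩
  - s + t       ≡⟨ +-comm (- s) t ⟩
  t - s         ∎
  where open ≡-Reasoning

minus-neg : ∀ s t → s - - t ≡ s + t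
minus-neg s t = cong (_+_ s) (neg-involutive t)

0≤s⇒0≤t⇒0≤s*t : 0ℤ ≤ℤ s → 0ℤ ≤ℤ t → 0ℤ ≤ℤ s * t
0≤s⇒0≤t⇒0≤s*t {+ m} {+ n} _ _ = subst (0ℤ ≤ℤ_) (pos-* m n) (+≤+ z≤n)

0≤s⇒0≤t⇒0≤-s*-t : 0ℤ ≤ℤ s → 0ℤ ≤ℤ t → 0ℤ ≤ℤ - s * - t
0≤s⇒0≤t⇒0≤-s*-t {s} {t} 0≤s 0≤t = subst (0ℤ ≤ℤ_) (sym (neg-*-neg s t)) (0≤s⇒0≤t⇒0≤s*t 0≤s 0≤t)

0≤s⇒0≤t⇒s*-t≤0 : 0ℤ ≤ℤ s → 0ℤ ≤ℤ t → s * - t ≤ℤ 0ℤ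
0≤s⇒0≤t⇒s*-t≤0 {s} {t} 0≤s 0≤t = subst (_≤ℤ 0ℤ) (neg-distribʳ-* s t) (neg-mono-≤ (0≤s⇒0≤t⇒0≤s*t 0≤s 0≤t))

0≤s*t⇒sameSign : ∀ s t → 0ℤ ≤ℤ s * t → (0ℤ ≤ℤ s × 0ℤ ≤ℤ t) ⊎ (s ≤ℤ 0ℤ × t ≤ℤ 0ℤ)
0≤s*t⇒sameSign (+ m)     (+ n)     _  = inj₁ (+≤+ z≤n , +≤+ z≤n)
0≤s*t⇒sameSign +0        -[1+ n ]  _  = inj₂ (+≤+ z≤n , -≤+)
0≤s*t⇒sameSign +[1+ m ]  -[1+ n ]  ()
0≤s*t⇒sameSign -[1+ m ]  +0        _  = inj₂ (-≤+ , +≤+ z≤n)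
0≤s*t⇒sameSign -[1+ m ]  +[1+ n ]  ()
0≤s*t⇒sameSign -[1+ m ]  -[1+ n ]  _  = inj₂ (-≤+ , -≤+)

s*t≤0⇒oppositeSign : ∀ s t → s * t ≤ℤ 0ℤ → (0ℤ ≤ℤ s × t ≤ℤ 0ℤ) ⊎ (s ≤ℤ 0ℤ × 0ℤ ≤ℤ t)
s*t≤0⇒oppositeSign +0        (+ n)     _        = inj₂ (+≤+ z≤n , +≤+ z≤n)
s*t≤0⇒oppositeSign +[1+ m ]  +0        _        = inj₁ (+≤+ z≤n , +≤+ z≤n)
s*t≤0⇒oppositeSign +[1+ m ]  +[1+ n ]  (+≤+ ())
s*t≤0⇒oppositeSign (+ m)     -[1+ n ]  _        = inj₁ (+≤+ z≤n , -≤+)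
s*t≤0⇒oppositeSign -[1+ m ]  (+ n)     _        = inj₂ (-≤+ , +≤+ z≤n)
s*t≤0⇒oppositeSign -[1+ m ]  -[1+ n ]  (+≤+ ())

signed : Sign → ℤ → ℤ
signed Sign.+ s = s
signed Sign.- s = - s

data Orientation {n : ℕ} (i j : Fin n) : Sign → Set where
  ascending  : i <ᶠ j → Orientation i j Sign.+
  descending : j <ᶠ i → Orientation i j Sign.-

orientation : a ≢ b → ∃[ ε ] Orientation a b ε
orientation {a = a} {b} a≢b with <-cmp a b
... | tri< a<b _ _   = Sign.+ , ascending a<b
... | tri≈ _ a≡b _   = ⊥-elim (a≢b a≡b)
... | tri> _ _ b<a   = Sign.- , descending b<a

orientation⇒≢ : Orientation a b ε → a ≢ b
orientation⇒≢ (ascending a<b)  refl = <-irrefl refl a<b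
orientation⇒≢ (descending b<a) refl = <-irrefl refl b<a

orientation-flip : Orientation a b ε → Orientation b a (opposite ε)
orientation-flip (ascending a<b)  = descending a<b
orientation-flip (descending b<a) = ascending b<a

data Realizable : Sign → Sign → Sign → Set where
  monotone : ∀ ε → Realizable ε ε ε
  turning  : ∀ ε γ → Realizable ε (opposite ε) γ

record Triangle (n : ℕ) (ε δ γ : Sign) : Set where
  constructor triangle
  field
    {i j k} : Fin n
    ij : Orientation i j ε
    jk : Orientation j k δ
    ik : Orientation i k γ

triangle⇒realizable : Triangle n ε δ γ → Realizable ε δ γ
triangle⇒realizable (triangle (ascending _)    (ascending _)    (ascending _))    = monotone Sign.+
triangle⇒realizable (triangle (ascending i<j)  (ascending j<k)  (descending k<i)) = ⊥-elim (<-asym (<-trans i<j j<k) k<i)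
triangle⇒realizable (triangle (ascending _)    (descending _)   _)                = turning Sign.+ _
triangle⇒realizable (triangle (descending _)   (ascending _)    _)                = turning Sign.- _
triangle⇒realizable (triangle (descending j<i) (descending k<j) (ascending i<k))  = ⊥-elim (<-asym (<-trans k<j j<i) i<k)
triangle⇒realizable (triangle (descending _)   (descending _)   (descending _))   = monotone Sign.-

module _ {m : ℕ} where
  private
    0↗1 : Orientation {3 ℕ.+ m} zero (suc zero) Sign.+
    0↗1 = ascending (s≤s z≤n)

    1↗2 : Orientation {3 ℕ.+ m} (suc zero) (suc (suc zero)) Sign.+
    1↗2 = ascending (s≤s (s≤s z≤n))

    0↗2 : Orientation {3 ℕ.+ m} zero (suc (suc zero)) Sign.+
    0↗2 = ascending (s≤s z≤n)

    1↘0 : Orientation {3 ℕ.+ m} (suc zero) zero Sign.-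
    1↘0 = orientation-flip 0↗1

    2↘1 : Orientation {3 ℕ.+ m} (suc (suc zero)) (suc zero) Sign.-
    2↘1 = orientation-flip 1↗2

    2↘0 : Orientation {3 ℕ.+ m} (suc (suc zero)) zero Sign.-
    2↘0 = orientation-flip 0↗2

  realizable⇒triangle : Realizable ε δ γ → Triangle (3 ℕ.+ m) ε δ γ
  realizable⇒triangle (monotone Sign.+)       = triangle 0↗1 1↗2 0↗2
  realizable⇒triangle (monotone Sign.-)       = triangle 2↘1 1↘0 2↘0
  realizable⇒triangle (turning Sign.+ Sign.+) = triangle 0↗2 2↘1 0↗1
  realizable⇒triangle (turning Sign.+ Sign.-) = triangle 1↗2 2↘0 1↘0
  realizable⇒triangle (turning Sign.- Sign.+) = triangle 1↘0 0↗2 1↗2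
  realizable⇒triangle (turning Sign.- Sign.-) = triangle 2↘0 0↗1 2↘1

module _ (S : ℤ → Set) where

  ∉-resp : s ≡ t → ¬ S s → ¬ S t
  ∉-resp = subst (λ x → ¬ S x)

  ∉-signed : ¬ S s × ¬ S (- s) → ∀ γ → ¬ S (signed γ s)
  ∉-signed (∉s , _)   Sign.+ = ∉s
  ∉-signed (_  , ∉-s) Sign.- = ∉-s

  ∉𝒜⇒∉S : Orientation a b ε → ¬ 𝒜 S n a b s → ¬ S (signed ε s)
  ∉𝒜⇒∉S (ascending a<b)  ∉𝒜 x = ∉𝒜 (inj₁ (a<b , x))
  ∉𝒜⇒∉S (descending b<a) ∉𝒜 x = ∉𝒜 (inj₂ (b<a , x))

  ∉S⇒∉𝒜 : Orientation a b ε → ¬ S (signed ε s) → ¬ 𝒜 S n a b s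
  ∉S⇒∉𝒜 (ascending a<b)  ∉S (inj₁ (_ , x))    = ∉S x
  ∉S⇒∉𝒜 (ascending a<b)  _  (inj₂ (b<a , _))  = <-asym a<b b<a
  ∉S⇒∉𝒜 (descending b<a) _  (inj₁ (a<b , _))  = <-asym a<b b<a
  ∉S⇒∉𝒜 (descending b<a) ∉S (inj₂ (_ , x))    = ∉S x

  OrientedSumClosed : Set
  OrientedSumClosed =
    ∀ {ε δ γ} → Realizable ε δ γ → ∀ {s t} → 0ℤ ≤ℤ s → 0ℤ ≤ℤ t →
    ¬ S (signed ε s) → ¬ S (signed δ t) → ¬ S (signed γ (s + t))

  orientedSumClosed⇒stronglyTransitive : OrientedSumClosed → (n : ℕ) → StronglyTransitive (𝒜 S n)
  orientedSumClosed⇒stronglyTransitive closed _ i j k i≢j j≢k i≢k s t 0≤s 0≤t ∉ij ∉jk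
    with orientation i≢j | orientation j≢k | orientation i≢k
  ... | _ , ij | _ , jk | _ , ik =
    ∉S⇒∉𝒜 ik (closed (triangle⇒realizable (triangle ij jk ik)) 0≤s 0≤t (∉𝒜⇒∉S ij ∉ij) (∉𝒜⇒∉S jk ∉jk))

  stronglyTransitive⇒orientedSumClosed : 3 ≤ n → StronglyTransitive (𝒜 S n) → OrientedSumClosed
  stronglyTransitive⇒orientedSumClosed (s≤s (s≤s (s≤s _))) st realizable {s} {t} 0≤s 0≤t ∉s ∉t
    with realizable⇒triangle realizable
  ... | triangle ij jk ik =
    ∉𝒜⇒∉S ik (st _ _ _ (orientation⇒≢ ij) (orientation⇒≢ jk) (orientation⇒≢ ik) s t 0≤s 0≤t
                  (∉S⇒∉𝒜 ij ∉s) (∉S⇒∉𝒜 jk ∉t))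

  cond3⇒∉±sum : Cond3 S → 0ℤ ≤ℤ s → 0ℤ ≤ℤ t → ¬ S s → ¬ S (- t) → ¬ S (s + t) × ¬ S (- (s + t))
  cond3⇒∉±sum {s} {t} cond3 0≤s 0≤t ∉s ∉-t =
    map (∉-resp (minus-neg s t)) (∉-resp (sym -[s+t]≡-t-s))
        (proj₂ (cond3 s (- t) ∉s ∉-t) (0≤s⇒0≤t⇒s*-t≤0 0≤s 0≤t))
    where
    -[s+t]≡-t-s : - (s + t) ≡ - t - s
    -[s+t]≡-t-s = trans (neg-distrib-+ s t) (+-comm (- s) (- t))

  cond3⇒orientedSumClosed : Cond3 S → OrientedSumClosed
  cond3⇒orientedSumClosed cond3 (monotone Sign.+) {s} {t} 0≤s 0≤t ∉s ∉t =
    proj₁ (cond3 s t ∉s ∉t) (0≤s⇒0≤t⇒0≤s*t 0≤s 0≤t)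
  cond3⇒orientedSumClosed cond3 (monotone Sign.-) {s} {t} 0≤s 0≤t ∉-s ∉-t =
    ∉-resp (sym (neg-distrib-+ s t)) (proj₁ (cond3 (- s) (- t) ∉-s ∉-t) (0≤s⇒0≤t⇒0≤-s*-t 0≤s 0≤t))
  cond3⇒orientedSumClosed cond3 (turning Sign.+ γ) 0≤s 0≤t ∉s ∉-t =
    ∉-signed (cond3⇒∉±sum cond3 0≤s 0≤t ∉s ∉-t) γ
  cond3⇒orientedSumClosed cond3 (turning Sign.- γ) {s} {t} 0≤s 0≤t ∉-s ∉t =
    ∉-signed (map (∉-resp (+-comm t s)) (∉-resp (cong -_ (+-comm t s)))
                  (cond3⇒∉±sum cond3 0≤t 0≤s ∉t ∉-s)) γ

  orientedSumClosed⇒∉differences : OrientedSumClosed → 0ℤ ≤ℤ s → t ≤ℤ 0ℤ → ¬ S s → ¬ S t →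
                                   ¬ S (s - t) × ¬ S (t - s)
  orientedSumClosed⇒∉differences {s} {t} closed 0≤s t≤0 ∉s ∉t =
    closed (turning Sign.+ Sign.+) 0≤s 0≤-t ∉s ∉--t ,
    ∉-resp (neg-minus s t) (closed (turning Sign.+ Sign.-) 0≤s 0≤-t ∉s ∉--t)
    where
    0≤-t : 0ℤ ≤ℤ - t
    0≤-t = neg-mono-≤ t≤0
    ∉--t : ¬ S (- - t)
    ∉--t = ∉-resp (sym (neg-involutive t)) ∉t

  orientedSumClosed⇒cond3 : OrientedSumClosed → Cond3 S
  orientedSumClosed⇒cond3 closed s t ∉s ∉t = ∉sum , ∉differences
    where
    -[-s+-t]≡s+t : - (- s + - t) ≡ s + t
    -[-s+-t]≡s+t = trans (neg-distrib-+ (- s) (- t)) (cong₂ _+_ (neg-involutive s) (neg-involutive t))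
    ∉sum : 0ℤ ≤ℤ s * t → ¬ S (s + t)
    ∉sum 0≤st with 0≤s*t⇒sameSign s t 0≤st
    ... | inj₁ (0≤s , 0≤t) = closed (monotone Sign.+) 0≤s 0≤t ∉s ∉t
    ... | inj₂ (s≤0 , t≤0) =
      ∉-resp -[-s+-t]≡s+t (closed (monotone Sign.-) (neg-mono-≤ s≤0) (neg-mono-≤ t≤0)
                     (∉-resp (sym (neg-involutive s)) ∉s) (∉-resp (sym (neg-involutive t)) ∉t))
    ∉differences : s * t ≤ℤ 0ℤ → ¬ S (s - t) × ¬ S (t - s)
    ∉differences st≤0 with s*t≤0⇒oppositeSign s t st≤0
    ... | inj₁ (0≤s , t≤0) = orientedSumClosed⇒∉differences closed 0≤s t≤0 ∉s ∉t
    ... | inj₂ (s≤0 , 0≤t) = swap (orientedSumClosed⇒∉differences closed 0≤t s≤0 ∉t ∉s)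

lemma3p9 : (S : ℤ → Set) →
    (((n : ℕ) → 0 < n → StronglyTransitive (𝒜 S n))
      ⇔ (∃[ n ] (3 ≤ n × StronglyTransitive (𝒜 S n))))
    × ((∃[ n ] (3 ≤ n × StronglyTransitive (𝒜 S n))) ⇔ Cond3 S)
lemma3p9 S =
    mk⇔ (λ all → 3 , 3≤3 , all 3 (s≤s z≤n))
        (λ some n _ → orientedSumClosed⇒stronglyTransitive S (some⇒closed some) n)
  , mk⇔ (λ some → orientedSumClosed⇒cond3 S (some⇒closed some))
        (λ cond3 → 3 , 3≤3 , orientedSumClosed⇒stronglyTransitive S (cond3⇒orientedSumClosed S cond3) 3)
  where
  3≤3 : 3 ≤ 3
  3≤3 = s≤s (s≤s (s≤s z≤n))

  some⇒closed : ∃[ n ] (3 ≤ n × StronglyTransitive (𝒜 S n)) → OrientedSumClosed S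
  some⇒closed (_ , 3≤n , st) = stronglyTransitive⇒orientedSumClosed S 3≤n st
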